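{- Let $W_{\Delta,n}$ be a Knödel graph with $\Delta\ge3$ and $n\ge 4(\Delta-3)(2^{\Delta-1}-1)+4$, and let $s=2^{\Delta-1}-1$. Then, for $i\in\{0,1,\dots,n/2-1\}$: (i) if $0\le i\le(\Delta-3)s$, then $d(u_0,u_i)\le 2(\Delta-2)$; (ii) if $(\Delta-3)s+1\le\min\{i,\,n/2-i\}$, then $d(u_0,u_i)=d(u_0,u_{n/2-i})=2\left\lceil\frac{\min\{i,\,n/2-i\}}{s}\right\rceil$.
   Context: Knödel graph: for an even integer $n$ and an integer $\Delta$ with $1\le\Delta\le\lfloor\log_2 n\rfloor$, $W_{\Delta,n}$ is the simple bipartite graph with vertex set $U\cup V$, $U=\{u_0,\dots,u_{n/2-1}\}$, $V=\{v_0,\dots,v_{n/2-1}\}$; indices are read modulo $n/2$. The vertices $u_i$ and $v_j$ are adjacent iff $j-i\equiv 2^k-1\pmod{n/2}$ for some $k\in\{0,\dots,\Delta-1\}$; no other edges. $d(x,y)$ is the graph distance. -}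

module Defs where

open import Data.Nat using (ℕ; zero; suc; _+_; _*_; _∸_; _^_; _≤_)
open import Data.Nat.DivMod using (_/_)
open import Data.Fin using (Fin; toℕ)
open import Data.Integer as ℤ using (ℤ; +_)
open import Data.Integer.Divisibility using () renaming (_∣_ to _∣ℤ_)
open import Data.Product using (Σ; ∃; _×_)
open import Data.Empty using (⊥)

data Side : Set where
  U V : Side

-- Vertices of W_{Δ,n} with m = n/2: a side and an index in Z_m (represented by Fin m).
Vertex : ℕ → Set
Vertex m = Side × Fin m

open import Data.Product using (_,_) public

u : ∀ {m} → Fin m → Vertex m
u i = U , i

KEdge : (Δ m : ℕ) → Fin m → Fin m → Set
KEdge Δ m i j =
  Σ ℕ λ k → (suc k ≤ Δ) ×
    ((+ m) ∣ℤ ((+ toℕ j ℤ.- + toℕ i) ℤ.- + (2 ^ k ∸ 1)))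

KAdj : (Δ m : ℕ) → Vertex m → Vertex m → Set
KAdj Δ m (U , i) (V , j) = KEdge Δ m i j
KAdj Δ m (V , j) (U , i) = KEdge Δ m i j
KAdj Δ m (U , _) (U , _) = ⊥
KAdj Δ m (V , _) (V , _) = ⊥

data Walk {A : Set} (Adj : A → A → Set) : A → A → ℕ → Set where
  nil  : ∀ {x} → Walk Adj x x 0
  cons : ∀ {x y z k} → Adj x y → Walk Adj y z k → Walk Adj x z (suc k)

IsDist : {A : Set} (Adj : A → A → Set) → A → A → ℕ → Set
IsDist Adj x y d = Walk Adj x y d × (∀ k → Walk Adj x y k → d ≤ k)

-- Ceiling division ⌈a / s⌉ (for s ≥ 1; value at s = 0 is irrelevant).
ceilDiv : ℕ → ℕ → ℕ
ceilDiv a zero = 0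
ceilDiv a (suc s) = (a + s) / suc s

module Submission where

-- Write ones k = 2^k − 1 and s = ones (Δ − 1).  A path u_x → v_y → u_z moves
-- the index by a "hop" ones p − ones q with p, q < Δ, so every walk u → u of
-- length 2t shifts the index (mod m) by a sum of t hops, each of absolute
-- value at most s; conversely every such sum is realised by a walk.

open import Defs

open import Data.Nat as ℕ
  using (ℕ; zero; suc; _+_; _*_; _∸_; _^_; _≤_; _<_; _⊓_; z≤n; s≤s; NonZero; _≤?_)
open import Data.Nat.Properties as ℕ
  using ( ≤-refl; ≤-trans; ≤-antisym; <⇒≤; ≤-<-trans; ≤-pred; ≰⇒>; ≮⇒≥; <⇒≱; ≤-total; ≤-reflexive
        ; m≤m+n; m≤n+m; m<m+n; m∸n≤m; m∸n≡0⇒m≤n; n≤0⇒n≡0; ∸-monoˡ-≤; m+n∸m≡n; m+n∸n≡m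
        ; m+[n∸m]≡n; m∸n+n≡m; +-assoc; +-comm; +-identityʳ; +-suc; +-monoʳ-<; +-cancelˡ-≤
        ; *-comm; *-suc; *-distribˡ-+; *-distribˡ-∸; *-monoˡ-≤; *-monoʳ-≤; *-cancelˡ-<
        ; m^n>0; ^-monoʳ-≤; m⊓n≤m; m⊓n≤n; ⊓-comm; m≤n⇒m⊓n≡m; m≥n⇒m⊓n≡n; anyUpTo? )
open import Data.Nat.DivMod using (_/_; _%_; m≡m%n+[m/n]*n; m%n<n; m<n*o⇒m/o<n)
import Data.Nat.Divisibility as ℕ
open import Data.Nat.Induction using (<-rec)
open import Data.Nat.Tactic.RingSolver as ℕ-Ring using ()
open import Data.Integer as ℤ using (ℤ; +_; -[1+_]; 0ℤ; -_; ∣_∣)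
import Data.Integer.Properties as ℤ
open import Data.Integer.DivMod using (_%ℕ_; _/ℕ_; n%ℕd<d; a≡a%ℕn+[a/ℕn]*n)
open import Data.Integer.Divisibility.Signed as ℤ∣
  using (divides; ∣ᵤ⇒∣; ∣⇒∣ᵤ; ∣m∣n⇒∣m+n; ∣m⇒∣-m)
open import Data.Integer.Tactic.RingSolver as ℤ-Ring using ()
open import Data.Fin as Fin using (Fin; toℕ; fromℕ<)
open import Data.Fin.Properties as Fin using (toℕ-fromℕ<; toℕ-injective; toℕ<n)
open import Data.Product using (Σ; ∃; _×_; _,_)
open import Data.Product.Properties using (≡-dec)
open import Data.Sum using (inj₁; inj₂)
open import Data.List using (_∷_; [])
open import Function using (_∘_)
open import Relation.Nullary using (Dec; yes; no; contradiction)
open import Relation.Nullary.Decidable using (map′; _×-dec_; _⊎-dec_)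
open import Relation.Binary using (Setoid; DecidableEquality)
import Relation.Binary.Reasoning.Setoid as SetoidReasoning
open import Relation.Binary.PropositionalEquality
  using (_≡_; refl; sym; trans; cong; cong₂; subst; subst₂; module ≡-Reasoning)

-- ones k = 2^k − 1: the edge lengths of W_{Δ,2m} are ones 0, …, ones (Δ − 1).
ones : ℕ → ℕ
ones k = 2 ^ k ∸ 1

pow≡suc-ones : ∀ k → 2 ^ k ≡ suc (ones k)
pow≡suc-ones k = sym (m+[n∸m]≡n (m^n>0 2 k))

ones-suc : ∀ k → ones (suc k) ≡ suc (2 * ones k)
ones-suc k = begin
  ones (suc k)         ≡⟨ cong (λ x → 2 * x ∸ 1) (pow≡suc-ones k) ⟩
  2 * suc (ones k) ∸ 1 ≡⟨ cong (_∸ 1) (*-suc 2 (ones k)) ⟩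
  suc (2 * ones k)     ∎
  where open ≡-Reasoning

ones-below : ∀ {p Δ} → p < Δ → ones p ≤ ones (Δ ∸ 1)
ones-below (s≤s p≤Δ) = ∸-monoˡ-≤ 1 (^-monoʳ-≤ 2 p≤Δ)

ceilDiv-upper : ∀ c s → 1 ≤ s → c ≤ ceilDiv c s * s
ceilDiv-upper c (suc s) _ = +-cancelˡ-≤ s c (q * suc s) c+s≤s+q*[1+s]
  where
  q = (c + s) / suc s
  c+s≤s+q*[1+s] : s + c ≤ s + q * suc s
  c+s≤s+q*[1+s] = begin
    s + c                       ≡⟨ +-comm s c ⟩
    c + s                       ≡⟨ m≡m%n+[m/n]*n (c + s) (suc s) ⟩
    (c + s) % suc s + q * suc s ≤⟨ ℕ.+-monoˡ-≤ (q * suc s) (≤-pred (m%n<n (c + s) (suc s))) ⟩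
    s + q * suc s               ∎
    where open ℕ.≤-Reasoning

ceilDiv-least : ∀ c s t → c ≤ t * s → ceilDiv c s ≤ t
ceilDiv-least c zero    t _   = z≤n
ceilDiv-least c (suc s) t c≤ =
  ≤-pred (m<n*o⇒m/o<n (subst (c + s <_) (+-comm (t * suc s) (suc s)) (ℕ.+-mono-≤-< c≤ (ℕ.n<1+n s))))

ceilDiv-above : ∀ {c s t} → 1 ≤ s → t * s < c → suc t ≤ ceilDiv c s
ceilDiv-above {c} {s} {t} 1≤s t*s<c = ≮⇒≥ λ ⌈c/s⌉≤t →
  <⇒≱ t*s<c (≤-trans (ceilDiv-upper c s 1≤s) (*-monoˡ-≤ s (≤-pred ⌈c/s⌉≤t)))

-- block p q = 2^p − 2^q; for q ≤ p its binary digits are ones exactly in positions q … p − 1.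
block : ℕ → ℕ → ℕ
block p q = 2 ^ p ∸ 2 ^ q

data Blocks (L : ℕ) : ℕ → ℕ → Set where
  []  : Blocks L 0 0
  add : ∀ {t c} p q → q ≤ p → p ≤ L → Blocks L t c → Blocks L (suc t) (block p q + c)

block-double : ∀ p q → block (suc p) (suc q) ≡ 2 * block p q
block-double p q = sym (*-distribˡ-∸ 2 (2 ^ p) (2 ^ q))

block-bit : ∀ {b} → b ≤ 1 → block b 0 ≡ b
block-bit z≤n       = refl
block-bit (s≤s z≤n) = refl

block-top : ∀ {b} k → b ≤ 1 → block (suc k) (1 ∸ b) ≡ b + 2 * ones k
block-top k z≤n       = block-double k 0
block-top k (s≤s z≤n) = ones-suc k

double : ∀ {L t c} → Blocks L t c → Blocks (suc L) t (2 * c)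
double [] = []
double (add {c = c} p q q≤p p≤L bs) =
  subst (Blocks _ _) double-sum (add (suc p) (suc q) (s≤s q≤p) (s≤s p≤L) (double bs))
  where
  double-sum : block (suc p) (suc q) + 2 * c ≡ 2 * (block p q + c)
  double-sum = trans (cong (_+ 2 * c) (block-double p q)) (sym (*-distribˡ-+ 2 (block p q) c))

repeat : ∀ {L t c} r p q → q ≤ p → p ≤ L → Blocks L t c → Blocks L (r + t) (r * block p q + c)
repeat zero    p q _   _   bs = bs
repeat (suc r) p q q≤p p≤L bs =
  subst (Blocks _ _) (sym (+-assoc (block p q) (r * block p q) _)) (add p q q≤p p≤L (repeat r p q q≤p p≤L bs))

Covers : ℕ → ℕ → Set
Covers L t = ∀ c → c ≤ t * ones L → Blocks L t c

halving : ∀ c → Σ ℕ λ b → Σ ℕ λ q → b ≤ 1 × c ≡ b + 2 * q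
halving c = c % 2 , c / 2 , ≤-pred (m%n<n c 2) , trans (m≡m%n+[m/n]*n c 2) (cong (_+_ (c % 2)) (*-comm (c / 2) 2))

above-one-period : ∀ N q → N * ones (suc N) < q → ones (suc N) ≤ q
above-one-period zero    q 0<q = 0<q
above-one-period (suc N) q lt  = ≤-trans (m≤m+n (ones (2 + N)) (N * ones (2 + N))) (<⇒≤ lt)

-- Inductive step for halvable numbers: b + 2q with q < (N+1)·S, S = ones (N + 1), is
-- represented by N + 1 blocks of exponent ≤ N + 2: a low block b and the doubled
-- representation of q, or, if q is too large for that, a top block 2S + b and the doubled q − S.
halves : ∀ N → Covers (suc N) N → ∀ b q → b ≤ 1 → q < suc N * ones (suc N)
       → Blocks (2 + N) (suc N) (b + 2 * q)
halves N cover b q b≤1 q< with q ≤? N * ones (suc N)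
... | yes q≤ = subst (Blocks (2 + N) (suc N)) (cong (_+ 2 * q) (block-bit b≤1))
                 (add b 0 z≤n (≤-trans b≤1 (s≤s z≤n)) (double (cover q q≤)))
... | no q≰ = subst (Blocks (2 + N) (suc N)) top+rest
                (add (2 + N) (1 ∸ b) (≤-trans (m∸n≤m 1 b) (s≤s z≤n)) ≤-refl (double (cover (q ∸ S) rest≤)))
  where
  S = ones (suc N)
  S≤q : S ≤ q
  S≤q = above-one-period N q (≰⇒> q≰)
  rest≤ : q ∸ S ≤ N * S
  rest≤ = ≤-trans (∸-monoˡ-≤ S (<⇒≤ q<)) (≤-reflexive (m+n∸m≡n S (N * S)))
  top+rest : block (2 + N) (1 ∸ b) + 2 * (q ∸ S) ≡ b + 2 * q
  top+rest = begin
    block (2 + N) (1 ∸ b) + 2 * (q ∸ S) ≡⟨ cong (_+ 2 * (q ∸ S)) (block-top (suc N) b≤1) ⟩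
    b + 2 * S + 2 * (q ∸ S)             ≡⟨ +-assoc b (2 * S) (2 * (q ∸ S)) ⟩
    b + (2 * S + 2 * (q ∸ S))           ≡⟨ cong (_+_ b) (sym (*-distribˡ-+ 2 S (q ∸ S))) ⟩
    b + 2 * (S + (q ∸ S))               ≡⟨ cong (λ x → b + 2 * x) (m+[n∸m]≡n S≤q) ⟩
    b + 2 * q                           ∎
    where open ≡-Reasoning

-- Inductive step near the top of the range: if c ≥ (N+1)·2S then c = (N+1)·2S + r with
-- r ≤ N + 1, which is r blocks 2^(N+2) − 1 = 2S + 1 and N + 1 − r blocks 2^(N+2) − 2 = 2S.
saturated : ∀ N c → suc N * (2 * ones (suc N)) ≤ c → c ≤ suc N * ones (2 + N)
          → Blocks (2 + N) (suc N) c
saturated N c KT≤c c≤ = subst₂ (Blocks (2 + N)) count total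
  (repeat r (2 + N) 0 z≤n ≤-refl (repeat (K ∸ r) (2 + N) 1 (s≤s z≤n) ≤-refl []))
  where
  K = suc N
  T = 2 * ones (suc N)
  r = c ∸ K * T
  r≤K : r ≤ K
  r≤K = begin
    c ∸ K * T           ≤⟨ ∸-monoˡ-≤ (K * T) c≤ ⟩
    K * ones (2 + N) ∸ K * T ≡⟨ cong (λ x → K * x ∸ K * T) (ones-suc (suc N)) ⟩
    K * suc T ∸ K * T   ≡⟨ cong (_∸ K * T) (*-suc K T) ⟩
    K + K * T ∸ K * T   ≡⟨ m+n∸n≡m K (K * T) ⟩
    K                   ∎
    where open ℕ.≤-Reasoning
  count : r + ((K ∸ r) + 0) ≡ K
  count = trans (cong (_+_ r) (+-identityʳ (K ∸ r))) (m+[n∸m]≡n r≤K)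
  distribute : ∀ r k T → r * suc T + k * T ≡ r + (r + k) * T
  distribute = ℕ-Ring.solve-∀
  total : r * ones (2 + N) + ((K ∸ r) * block (2 + N) 1 + 0) ≡ c
  total = begin
    r * ones (2 + N) + ((K ∸ r) * block (2 + N) 1 + 0)
      ≡⟨ cong₂ (λ x y → r * x + y) (ones-suc (suc N))
               (trans (+-identityʳ _) (cong ((K ∸ r) *_) (block-double (suc N) 0))) ⟩
    r * suc T + (K ∸ r) * T ≡⟨ distribute r (K ∸ r) T ⟩
    r + (r + (K ∸ r)) * T   ≡⟨ cong (λ x → r + x * T) (m+[n∸m]≡n r≤K) ⟩
    r + K * T               ≡⟨ m∸n+n≡m KT≤c ⟩
    c                       ∎
    where open ≡-Reasoning

representation : ∀ N → Covers (suc N) N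
representation zero    c c≤0 = subst (Blocks 1 0) (sym (n≤0⇒n≡0 c≤0)) []
representation (suc N) c c≤ with suc N * (2 * ones (suc N)) ≤? c | halving c
... | yes large | _ = saturated N c large c≤
... | no small  | b , q , b≤1 , refl = halves N (representation N) b q b≤1 (*-cancelˡ-< 2 q (K * S) 2q<2KS)
  where
  K = suc N
  S = ones (suc N)
  reorder : ∀ K S → K * (2 * S) ≡ 2 * (K * S)
  reorder = ℕ-Ring.solve-∀
  2q<2KS : 2 * q < 2 * (K * S)
  2q<2KS = ≤-<-trans (m≤n+m (2 * q) b) (subst (b + 2 * q <_) (reorder K S) (≰⇒> small))

-- One more block (a full block ones L, or the empty block 2^0 − 2^0) covers one more period.
covers-step : ∀ {L t} → 1 ≤ t → Covers L t → Covers L (suc t)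
covers-step {L} {t} 1≤t cover c c≤ with ones L ≤? c
... | yes s≤c = subst (Blocks L (suc t)) (m+[n∸m]≡n s≤c) (add L 0 z≤n ≤-refl (cover (c ∸ ones L) rest≤))
  where
  rest≤ : c ∸ ones L ≤ t * ones L
  rest≤ = ≤-trans (∸-monoˡ-≤ (ones L) c≤) (≤-reflexive (m+n∸m≡n (ones L) (t * ones L)))
... | no c≱s = add 0 0 z≤n z≤n (cover c (≤-trans (<⇒≤ (≰⇒> c≱s)) one-period≤))
  where
  one-period≤ : ones L ≤ t * ones L
  one-period≤ = subst (_≤ t * ones L) (ℕ.*-identityˡ (ones L)) (*-monoˡ-≤ (ones L) 1≤t)

covers-beyond : ∀ {L N t} → 1 ≤ N → Covers L N → N ≤ t → Covers L t
covers-beyond {L} {N} 1≤N cover N≤t = subst (Covers L) (m∸n+n≡m N≤t) (widen (_ ∸ N))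
  where
  widen : ∀ k → Covers L (k + N)
  widen zero    = cover
  widen (suc k) = covers-step (≤-trans 1≤N (m≤n+m N k)) (widen k)

multiple-below : ∀ {m d} → m ℕ.∣ d → d < m → d ≡ 0
multiple-below {d = zero}  _   _   = refl
multiple-below {d = suc d} m∣d d<m = contradiction (ℕ.∣⇒≤ m∣d) (<⇒≱ d<m)

difference-ℕ : ∀ {a b} → b ≤ a → + a ℤ.- + b ≡ + (a ∸ b)
difference-ℕ {a} {b} b≤a = trans (ℤ.[+m]-[+n]≡m⊖n a b) (ℤ.⊖-≥ b≤a)

module Congruence (m : ℕ) where

  infix 4 _≡ₘ_
  record _≡ₘ_ (a b : ℤ) : Set where
    constructor congruent
    field difference : + m ℤ∣.∣ a ℤ.- b

  ≡⇒≡ₘ : ∀ {a b} → a ≡ b → a ≡ₘ b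
  ≡⇒≡ₘ {a} refl = congruent (divides 0ℤ (trans (ℤ.+-inverseʳ a) (sym (ℤ.*-zeroˡ (+ m)))))

  ≡ₘ-sym : ∀ {a b} → a ≡ₘ b → b ≡ₘ a
  ≡ₘ-sym {a} {b} (congruent m∣a-b) = congruent (subst (+ m ℤ∣.∣_) (negated a b) (∣m⇒∣-m m∣a-b))
    where
    negated : ∀ a b → - (a ℤ.- b) ≡ b ℤ.- a
    negated = ℤ-Ring.solve-∀

  ≡ₘ-trans : ∀ {a b c} → a ≡ₘ b → b ≡ₘ c → a ≡ₘ c
  ≡ₘ-trans {a} {b} {c} (congruent m∣a-b) (congruent m∣b-c) =
    congruent (subst (+ m ℤ∣.∣_) (telescope a b c) (∣m∣n⇒∣m+n m∣a-b m∣b-c))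
    where
    telescope : ∀ a b c → (a ℤ.- b) ℤ.+ (b ℤ.- c) ≡ a ℤ.- c
    telescope = ℤ-Ring.solve-∀

  +-congₘ : ∀ {a b c d} → a ≡ₘ b → c ≡ₘ d → a ℤ.+ c ≡ₘ b ℤ.+ d
  +-congₘ {a} {b} {c} {d} (congruent m∣a-b) (congruent m∣c-d) =
    congruent (subst (+ m ℤ∣.∣_) (regroup a b c d) (∣m∣n⇒∣m+n m∣a-b m∣c-d))
    where
    regroup : ∀ a b c d → (a ℤ.- b) ℤ.+ (c ℤ.- d) ≡ (a ℤ.+ c) ℤ.- (b ℤ.+ d)
    regroup = ℤ-Ring.solve-∀

  setoid : Setoid _ _
  setoid = record
    { Carrier = ℤ ; _≈_ = _≡ₘ_
    ; isEquivalence = record { refl = ≡⇒≡ₘ refl ; sym = ≡ₘ-sym ; trans = ≡ₘ-trans } }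

  module ≡ₘ-Reasoning = SetoidReasoning setoid

  complement : ∀ {x w} → x + w ≡ m → + x ≡ₘ - + w
  complement {x} {w} x+w≡m = congruent (divides (+ 1) (begin
    + x ℤ.- - + w  ≡⟨ cong (ℤ._+_ (+ x)) (ℤ.neg-involutive (+ w)) ⟩
    + (x + w)      ≡⟨ cong +_ x+w≡m ⟩
    + m            ≡⟨ sym (ℤ.*-identityˡ (+ m)) ⟩
    + 1 ℤ.* + m    ∎))
    where open ≡-Reasoning

  -- If +x ≡ y (mod m) and x + w = m, the offset y is at least min(x, w) in size:
  -- a shorter offset cannot wrap around the cycle ℤ/m.
  near-offset : ∀ x w y → x + w ≡ m → + x ≡ₘ y → x ⊓ w ≤ ∣ y ∣
  near-offset x zero    y        _     _ = ≤-trans (m⊓n≤n x 0) z≤n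
  near-offset x (suc w) (+ p)    x+w≡m (congruent m∣x-p) with x ≤? p
  ... | yes x≤p = ≤-trans (m⊓n≤m x (suc w)) x≤p
  ... | no  x≰p = contradiction (m∸n≡0⇒m≤n (multiple-below m∣x∸p x∸p<m)) x≰p
    where
    m∣x∸p : m ℕ.∣ (x ∸ p)
    m∣x∸p = subst (λ z → m ℕ.∣ ∣ z ∣) (difference-ℕ (<⇒≤ (≰⇒> x≰p))) (∣⇒∣ᵤ m∣x-p)
    x∸p<m : x ∸ p < m
    x∸p<m = ≤-<-trans (m∸n≤m x p) (subst (x <_) x+w≡m (m<m+n x (s≤s z≤n)))
  near-offset x (suc w) -[1+ p ] x+w≡m (congruent m∣x+p+1) with suc w ≤? suc p
  ... | yes w≤p = ≤-trans (m⊓n≤n x (suc w)) w≤p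
  ... | no  w≰p = contradiction (trans (sym (+-suc x p)) (multiple-below (∣⇒∣ᵤ m∣x+p+1) x+p+1<m)) λ ()
    where
    x+p+1<m : x + suc p < m
    x+p+1<m = subst (x + suc p <_) x+w≡m (+-monoʳ-< x (≰⇒> w≰p))

  natural-congruence : ∀ {a b} → b ≤ a → a < m → + a ≡ₘ + b → a ≡ b
  natural-congruence {a} {b} b≤a a<m (congruent m∣a-b) =
    ≤-antisym (m∸n≡0⇒m≤n (multiple-below m∣a∸b (≤-<-trans (m∸n≤m a b) a<m))) b≤a
    where
    m∣a∸b : m ℕ.∣ (a ∸ b)
    m∣a∸b = subst (λ z → m ℕ.∣ ∣ z ∣) (difference-ℕ b≤a) (∣⇒∣ᵤ m∣a-b)

  residue-unique : (a b : Fin m) → + toℕ a ≡ₘ + toℕ b → a ≡ b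
  residue-unique a b a≡b with ≤-total (toℕ a) (toℕ b)
  ... | inj₁ a≤b = toℕ-injective (sym (natural-congruence a≤b (toℕ<n b) (≡ₘ-sym a≡b)))
  ... | inj₂ b≤a = toℕ-injective (natural-congruence b≤a (toℕ<n a) a≡b)

  -- Two edges u_x — v_y — u_z with y ≡ x + P and y ≡ z + Q move the index by P − Q.
  hop-congruence : ∀ {X Y Z P Q} → Y ≡ₘ X ℤ.+ P → Y ≡ₘ Z ℤ.+ Q → Z ≡ₘ X ℤ.+ (P ℤ.- Q)
  hop-congruence {X} {Y} {Z} {P} {Q} Y≡X+P Y≡Z+Q = begin
    Z                     ≡⟨ ℤ-Ring.solve (Z ∷ Q ∷ []) ⟩
    (Z ℤ.+ Q) ℤ.- Q       ≈⟨ +-congₘ (≡ₘ-sym Y≡Z+Q) (≡⇒≡ₘ refl) ⟩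
    Y ℤ.- Q               ≈⟨ +-congₘ Y≡X+P (≡⇒≡ₘ refl) ⟩
    (X ℤ.+ P) ℤ.- Q       ≡⟨ ℤ-Ring.solve (X ∷ P ∷ Q ∷ []) ⟩
    X ℤ.+ (P ℤ.- Q)       ∎
    where open ≡ₘ-Reasoning

  subtracted : ∀ {Y Z Q} → Z ≡ₘ Y ℤ.- Q → Y ≡ₘ Z ℤ.+ Q
  subtracted {Y} {Z} {Q} Z≡Y-Q = begin
    Y                     ≡⟨ ℤ-Ring.solve (Y ∷ Q ∷ []) ⟩
    (Y ℤ.- Q) ℤ.+ Q       ≈⟨ +-congₘ (≡ₘ-sym Z≡Y-Q) (≡⇒≡ₘ refl) ⟩
    Z ℤ.+ Q               ∎
    where open ≡ₘ-Reasoning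

  shift : ∀ {X Y Z ε δ} → Y ≡ₘ X ℤ.+ ε → Z ≡ₘ Y ℤ.+ δ → Z ≡ₘ X ℤ.+ (ε ℤ.+ δ)
  shift {X} {Y} {Z} {ε} {δ} Y≡X+ε Z≡Y+δ = begin
    Z                     ≈⟨ Z≡Y+δ ⟩
    Y ℤ.+ δ               ≈⟨ +-congₘ Y≡X+ε (≡⇒≡ₘ refl) ⟩
    (X ℤ.+ ε) ℤ.+ δ       ≡⟨ ℤ.+-assoc X ε δ ⟩
    X ℤ.+ (ε ℤ.+ δ)       ∎
    where open ≡ₘ-Reasoning

  module _ .{{_ : NonZero m}} where

    residue : ℤ → Fin m
    residue z = fromℕ< (n%ℕd<d z m)

    residue-congruent : ∀ z → + toℕ (residue z) ≡ₘ z
    residue-congruent z = congruent (divides (- (z /ℕ m)) (begin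
      + toℕ (residue z) ℤ.- z                         ≡⟨ cong (λ r → + r ℤ.- z) (toℕ-fromℕ< (n%ℕd<d z m)) ⟩
      + (z %ℕ m) ℤ.- z                                ≡⟨ cong (ℤ._-_ (+ (z %ℕ m))) (a≡a%ℕn+[a/ℕn]*n z m) ⟩
      + (z %ℕ m) ℤ.- (+ (z %ℕ m) ℤ.+ z /ℕ m ℤ.* + m) ≡⟨ cancel (+ (z %ℕ m)) (z /ℕ m) (+ m) ⟩
      - (z /ℕ m) ℤ.* + m                             ∎))
      where
      open ≡-Reasoning
      cancel : ∀ r q k → r ℤ.- (r ℤ.+ q ℤ.* k) ≡ - q ℤ.* k
      cancel = ℤ-Ring.solve-∀

-- hopOffset p q: the index shift along u_x → v_{x + ones p} → u_{x + ones p − ones q}.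
hopOffset : ℕ → ℕ → ℤ
hopOffset p q = + ones p ℤ.- + ones q

data Hops (Δ : ℕ) : ℕ → ℤ → Set where
  []  : Hops Δ 0 0ℤ
  hop : ∀ {t δ} p q → p < Δ → q < Δ → Hops Δ t δ → Hops Δ (suc t) (hopOffset p q ℤ.+ δ)

hops-negate : ∀ {Δ t δ} → Hops Δ t δ → Hops Δ t (- δ)
hops-negate [] = []
hops-negate (hop {δ = δ} p q p<Δ q<Δ hs) =
  subst (Hops _ _) (reverse (+ ones p) (+ ones q) δ) (hop q p q<Δ p<Δ (hops-negate hs))
  where
  reverse : ∀ a b d → (b ℤ.- a) ℤ.+ - d ≡ - ((a ℤ.- b) ℤ.+ d)
  reverse = ℤ-Ring.solve-∀

hops-bound : ∀ {Δ t δ} → Hops Δ t δ → ∣ δ ∣ ≤ t * ones (Δ ∸ 1)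
hops-bound [] = z≤n
hops-bound (hop {δ = δ} p q p<Δ q<Δ hs) = ≤-trans (ℤ.∣i+j∣≤∣i∣+∣j∣ (hopOffset p q) δ)
  (ℕ.+-mono-≤ (subst (_≤ _) (cong ∣_∣ (sym (ℤ.[+m]-[+n]≡m⊖n (ones p) (ones q))))
                  (≤-trans (ℤ.∣m⊝n∣≤m⊔n (ones p) (ones q)) (ℕ.⊔-lub (ones-below p<Δ) (ones-below q<Δ))))
              (hops-bound hs))

block-offset : ∀ {p q} → q ≤ p → + block p q ≡ hopOffset p q
block-offset {p} {q} q≤p = begin
  + block p q           ≡⟨ cong +_ (cong₂ _∸_ (pow≡suc-ones p) (pow≡suc-ones q)) ⟩
  + (ones p ∸ ones q)   ≡⟨ sym (difference-ℕ (∸-monoˡ-≤ 1 (^-monoʳ-≤ 2 q≤p))) ⟩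
  hopOffset p q         ∎
  where open ≡-Reasoning

blocks-hops : ∀ {L t c} → Blocks L t c → Hops (suc L) t (+ c)
blocks-hops [] = []
blocks-hops (add {c = c} p q q≤p p≤L bs) =
  subst (λ o → Hops _ _ (o ℤ.+ + c)) (sym (block-offset q≤p))
    (hop p q (s≤s p≤L) (s≤s (≤-trans q≤p p≤L)) (blocks-hops bs))

least-witness : ∀ {P : ℕ → Set} → (∀ n → Dec (P n)) → ∀ {L} → P L
              → Σ ℕ λ d → (P d × (∀ k → P k → d ≤ k)) × d ≤ L
least-witness {P} P? {L} = <-rec Goal search L
  where
  Goal : ℕ → Set
  Goal L = P L → Σ ℕ λ d → (P d × (∀ k → P k → d ≤ k)) × d ≤ L
  search : ∀ L → (∀ {n} → n < L → Goal n) → Goal L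
  search L smaller pL with anyUpTo? P? L
  ... | no none = L , (pL , λ k pk → ≮⇒≥ λ k<L → none (k , k<L , pk)) , ≤-refl
  ... | yes (n , n<L , pn) with smaller n<L pn
  ...   | d , least , d≤n = d , least , ≤-trans d≤n (<⇒≤ n<L)

_++ʷ_ : ∀ {A : Set} {Adj : A → A → Set} {x y z j k} → Walk Adj x y j → Walk Adj y z k → Walk Adj x z (j + k)
nil          ++ʷ walk = walk
cons x~ rest ++ʷ walk = cons x~ (rest ++ʷ walk)

-- In a graph with decidable adjacency on a searchable vertex type with decidable
-- equality, walks of a given length are decidable, so every reachable vertex has a distance.
module ShortestWalks {A : Set} (Adj : A → A → Set) (adjacent? : ∀ x y → Dec (Adj x y))
                     (_≟_ : DecidableEquality A)
                     (exists? : ∀ {P : A → Set} → (∀ x → Dec (P x)) → Dec (∃ P)) where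

  walk? : ∀ k x z → Dec (Walk Adj x z k)
  walk? zero    x z = map′ (λ { refl → nil }) (λ { nil → refl }) (x ≟ z)
  walk? (suc k) x z = map′ (λ (y , x~y , walk) → cons x~y walk)
                           (λ { (cons {y = y} x~y walk) → y , x~y , walk })
                           (exists? λ y → adjacent? x y ×-dec walk? k y z)

  distance : ∀ {x z L} → Walk Adj x z L → Σ ℕ λ d → IsDist Adj x z d × d ≤ L
  distance {x} {z} = least-witness (λ k → walk? k x z)

_≟ˢ_ : DecidableEquality Side
U ≟ˢ U = yes refl
V ≟ˢ V = yes refl
U ≟ˢ V = no λ ()
V ≟ˢ U = no λ ()

vertex-exists? : ∀ {m} {P : Vertex m → Set} → (∀ x → Dec (P x)) → Dec (∃ P)
vertex-exists? P? = map′ (λ { (inj₁ (i , p)) → (U , i) , p ; (inj₂ (i , p)) → (V , i) , p })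
                         (λ { ((U , i) , p) → inj₁ (i , p) ; ((V , i) , p) → inj₂ (i , p) })
                         (Fin.any? (P? ∘ (U ,_)) ⊎-dec Fin.any? (P? ∘ (V ,_)))

module Knödel (Δ h : ℕ) where

  private
    m = suc h

  open Congruence m

  Graph : Vertex m → Vertex m → Set
  Graph = KAdj Δ m

  edge-congruence : ∀ {i j} → KEdge Δ m i j → Σ ℕ λ k → k < Δ × + toℕ j ≡ₘ + toℕ i ℤ.+ + ones k
  edge-congruence {i} {j} (k , k<Δ , m∣j-i-k) =
    k , k<Δ , congruent (subst (+ m ℤ∣.∣_) (reassociate (+ toℕ j) (+ toℕ i) (+ ones k)) (∣ᵤ⇒∣ m∣j-i-k))
    where
    reassociate : ∀ J I K → (J ℤ.- I) ℤ.- K ≡ J ℤ.- (I ℤ.+ K)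
    reassociate = ℤ-Ring.solve-∀

  congruence-edge : ∀ {i j k} → k < Δ → + toℕ j ≡ₘ + toℕ i ℤ.+ + ones k → KEdge Δ m i j
  congruence-edge {i} {j} {k} k<Δ (congruent m∣j-[i+k]) =
    k , k<Δ , ∣⇒∣ᵤ (subst (+ m ℤ∣.∣_) (reassociate (+ toℕ j) (+ toℕ i) (+ ones k)) m∣j-[i+k])
    where
    reassociate : ∀ J I K → J ℤ.- (I ℤ.+ K) ≡ (J ℤ.- I) ℤ.- K
    reassociate = ℤ-Ring.solve-∀

  two-steps : ∀ {p q} → p < Δ → q < Δ → (x : Fin m)
            → Σ (Fin m) λ z → Walk Graph (u x) (u z) 2 × + toℕ z ≡ₘ + toℕ x ℤ.+ hopOffset p q
  two-steps {p} {q} p<Δ q<Δ x =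
    z , cons {y = V , y} x→y (cons y→z nil) ,
    hop-congruence {X = + toℕ x} {P = + ones p} {Q = + ones q} y≡x+p y≡z+q
    where
    y = residue (+ toℕ x ℤ.+ + ones p)
    z = residue (+ toℕ y ℤ.- + ones q)
    y≡x+p : + toℕ y ≡ₘ + toℕ x ℤ.+ + ones p
    y≡x+p = residue-congruent _
    y≡z+q : + toℕ y ≡ₘ + toℕ z ℤ.+ + ones q
    y≡z+q = subtracted {Q = + ones q} (residue-congruent _)
    x→y : Graph (u x) (V , y)
    x→y = congruence-edge p<Δ y≡x+p
    y→z : Graph (V , y) (u z)
    y→z = congruence-edge q<Δ y≡z+q

  hops-walk : ∀ {t δ} → Hops Δ t δ → (x : Fin m)
            → Σ (Fin m) λ z → Walk Graph (u x) (u z) (2 * t) × + toℕ z ≡ₘ + toℕ x ℤ.+ δ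
  hops-walk [] x = x , nil , ≡⇒≡ₘ (sym (ℤ.+-identityʳ (+ toℕ x)))
  hops-walk {suc t} (hop p q p<Δ q<Δ hs) x =
    let y , step , y≡x+hop = two-steps p<Δ q<Δ x
        z , walk , z≡y+δ   = hops-walk hs y
    in z , subst (Walk Graph (u x) (u z)) (sym (*-suc 2 t)) (step ++ʷ walk) ,
       shift {X = + toℕ x} {ε = hopOffset p q} y≡x+hop z≡y+δ

  walk-hops : ∀ {a b k} → Walk Graph (u a) (u b) k
            → Σ ℕ λ t → Σ ℤ λ δ → k ≡ 2 * t × Hops Δ t δ × + toℕ b ≡ₘ + toℕ a ℤ.+ δ
  walk-hops {a} nil = 0 , 0ℤ , refl , [] , ≡⇒≡ₘ (sym (ℤ.+-identityʳ (+ toℕ a)))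
  walk-hops (cons {y = U , _} () _)
  walk-hops (cons {y = V , _} _ (cons {y = V , _} () _))
  walk-hops {a} (cons {y = V , y} a→y (cons {y = U , z} y→z walk))
    with edge-congruence {a} {y} a→y | edge-congruence {z} {y} y→z | walk-hops walk
  ... | p , p<Δ , y≡a+p | q , q<Δ , y≡z+q | t , δ , refl , hs , b≡z+δ =
    suc t , hopOffset p q ℤ.+ δ , sym (*-suc 2 t) , hop p q p<Δ q<Δ hs ,
    shift {X = + toℕ a} {Y = + toℕ z} {ε = hopOffset p q}
      (hop-congruence {X = + toℕ a} {P = + ones p} {Q = + ones q} y≡a+p y≡z+q) b≡z+δ

  walk-to : ∀ {t δ} → Hops Δ t δ → (x : Fin m) → + toℕ x ≡ₘ δ → Walk Graph (u Fin.zero) (u x) (2 * t)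
  walk-to {t} {δ} hs x x≡δ with hops-walk hs Fin.zero
  ... | z , walk , z≡0+δ = subst (λ v → Walk Graph (u Fin.zero) (u v) (2 * t)) (residue-unique z x z≡x) walk
    where
    z≡x : + toℕ z ≡ₘ + toℕ x
    z≡x = ≡ₘ-trans z≡0+δ (≡ₘ-trans (≡⇒≡ₘ (ℤ.+-identityˡ δ)) (≡ₘ-sym x≡δ))

  -- Lower bound: a walk u₀ → u_x, where x + w = m, has length at least 2⌈min(x, w)/s⌉,
  -- s = ones (Δ − 1), since t hops shift the index by at most t·s.
  walk-lower-bound : ∀ (x : Fin m) w {k} → toℕ x + w ≡ m → Walk Graph (u Fin.zero) (u x) k
                   → 2 * ceilDiv (toℕ x ⊓ w) (ones (Δ ∸ 1)) ≤ k
  walk-lower-bound x w x+w≡m walk with walk-hops walk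
  ... | t , δ , refl , hs , x≡0+δ =
    *-monoʳ-≤ 2 (ceilDiv-least _ _ t (≤-trans (near-offset (toℕ x) w δ x+w≡m x≡δ) (hops-bound hs)))
    where
    x≡δ : + toℕ x ≡ₘ δ
    x≡δ = ≡ₘ-trans x≡0+δ (≡⇒≡ₘ (ℤ.+-identityˡ δ))

  edge? : ∀ i j → Dec (KEdge Δ m i j)
  edge? i j = anyUpTo? (λ k → m ℕ.∣? ∣ (+ toℕ j ℤ.- + toℕ i) ℤ.- + ones k ∣) Δ

  adjacent? : ∀ x y → Dec (Graph x y)
  adjacent? (U , i) (V , j) = edge? i j
  adjacent? (V , j) (U , i) = edge? i j
  adjacent? (U , _) (U , _) = no λ ()
  adjacent? (V , _) (V , _) = no λ ()

  open ShortestWalks Graph adjacent? (≡-dec _≟ˢ_ Fin._≟_) vertex-exists? public using (distance)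

module Distances (n h : ℕ) where

  private
    Δ = 3 + n
    m = suc h
    N = suc n
    s = ones (suc N)

  open Knödel Δ h
  open Congruence m

  1≤s : 1 ≤ s
  1≤s = ones-below {1} {Δ} (s≤s (s≤s z≤n))

  -- Indices up to N·s are reached by N hops, hence lie within distance 2N.
  near-distance : (i : Fin m) → toℕ i ≤ N * s → Σ ℕ λ d → IsDist Graph (u Fin.zero) (u i) d × d ≤ 2 * N
  near-distance i i≤Ns = distance (walk-to (blocks-hops (representation N (toℕ i) i≤Ns)) i (≡⇒≡ₘ refl))

  -- Beyond n·s, the distance to u_x is exactly 2⌈c/s⌉ with c = min(x, m − x): at least N
  -- blocks are then needed, so the representation theorem gives a matching walk towards
  -- +c or −c, whichever side of the cycle c is measured on.
  far-distance : (x : Fin m) (w : ℕ) → toℕ x + w ≡ m → n * s + 1 ≤ toℕ x ⊓ w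
               → IsDist Graph (u Fin.zero) (u x) (2 * ceilDiv (toℕ x ⊓ w) s)
  far-distance x w x+w≡m bound =
    let δ , hops , x≡δ = toward-x
    in walk-to hops x x≡δ , λ k → walk-lower-bound x w x+w≡m
    where
    c = toℕ x ⊓ w
    t = ceilDiv c s
    blocks : Blocks (suc N) t c
    blocks = covers-beyond (s≤s z≤n) (representation N)
               (ceilDiv-above 1≤s (subst (_≤ c) (+-comm (n * s) 1) bound)) c (ceilDiv-upper c s 1≤s)
    toward-x : Σ ℤ λ δ → Hops Δ t δ × + toℕ x ≡ₘ δ
    toward-x with ≤-total (toℕ x) w
    ... | inj₁ x≤w = + c , blocks-hops blocks , ≡⇒≡ₘ (cong +_ (sym (m≤n⇒m⊓n≡m x≤w)))
    ... | inj₂ w≤x = - + c , hops-negate (blocks-hops blocks) ,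
                     ≡ₘ-trans (complement x+w≡m) (≡⇒≡ₘ (cong (λ v → - + v) (sym (m≥n⇒m⊓n≡n w≤x))))

  far-distances : (i j : Fin m) → toℕ i + toℕ j ≡ m → n * s + 1 ≤ toℕ i ⊓ toℕ j
                → IsDist Graph (u Fin.zero) (u i) (2 * ceilDiv (toℕ i ⊓ toℕ j) s)
                × IsDist Graph (u Fin.zero) (u j) (2 * ceilDiv (toℕ i ⊓ toℕ j) s)
  far-distances i j i+j≡m bound =
    far-distance i (toℕ j) i+j≡m bound ,
    subst (λ c → IsDist Graph (u Fin.zero) (u j) (2 * ceilDiv c s)) (⊓-comm (toℕ j) (toℕ i))
      (far-distance j (toℕ i) (trans (+-comm (toℕ j) (toℕ i)) i+j≡m)
        (subst (n * s + 1 ≤_) (⊓-comm (toℕ i) (toℕ j)) bound))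

mainTheorem9 : (Δ h : ℕ) → 3 ≤ Δ → 2 ^ Δ ≤ 2 * suc h
    → 4 * (Δ ∸ 3) * (2 ^ (Δ ∸ 1) ∸ 1) + 4 ≤ 2 * suc h
    → ((i : Fin (suc h)) → toℕ i ≤ (Δ ∸ 3) * (2 ^ (Δ ∸ 1) ∸ 1)
    → Σ ℕ λ d → IsDist (KAdj Δ (suc h)) (u Fin.zero) (u i) d × d ≤ 2 * (Δ ∸ 2))
    × ((i j : Fin (suc h)) → toℕ i + toℕ j ≡ suc h
    → (Δ ∸ 3) * (2 ^ (Δ ∸ 1) ∸ 1) + 1 ≤ toℕ i ⊓ toℕ j
    → IsDist (KAdj Δ (suc h)) (u Fin.zero) (u i) (2 * ceilDiv (toℕ i ⊓ toℕ j) (2 ^ (Δ ∸ 1) ∸ 1))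
    × IsDist (KAdj Δ (suc h)) (u Fin.zero) (u j) (2 * ceilDiv (toℕ i ⊓ toℕ j) (2 ^ (Δ ∸ 1) ∸ 1)))
mainTheorem9 (suc (suc (suc n))) h (s≤s (s≤s (s≤s z≤n))) _ _ =
  (λ i i≤ns → near-distance i (≤-trans i≤ns (m≤n+m (n * s) s))) , far-distances
  where
  open Distances n h
  s = ones (2 + n)
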